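{- Let $N$ be a neuron, $id,len\in\mathbb{N}$, and suppose $\mathit{One\_input}(N,id,len)$, that $N$ is initial, and that $w_N(id)<\tau_N$. Then for every list $\mathit{inp}$ of input functions, all booleans $a_1,a_2$ and lists of booleans $l_1,l_2$: if $Output_N(\mathit{inp},len)=l_1\mathbin{++}[a_1;a_2]\mathbin{++}l_2$, then $a_1=0$ or $a_2=0$.
   Context: Booleans are identified with $0$ (false) and $1$ (true). A neuron $N$ consists of an identifier $id_N\in\mathbb{N}$, a weight function $w_N:\mathbb{N}\to\mathbb{Q}$ with $-1\le w_N(x)\le 1$ for all $x$ and $w_N(id_N)=0$, a leak factor $lk_N\in\mathbb{Q}$ with $0\le lk_N\le 1$, a threshold $\tau_N\in\mathbb{Q}$ with $\tau_N>0$, an output list $Output(N)$ of booleans (most recent first) and a current potential $CurPot(N)\in\mathbb{Q}$, subject to: $(\tau_N\le CurPot(N))$ equals the head of $Output(N)$ (the head of an empty list being $0$). An input function is a map $i:\mathbb{N}\to\{0,1\}$; $potential(w,i,len)=\sum_{0\le k<len,\ i(k)=1} w(k)$. The one-step update of $N$ with input function $i$ in an environment of $len$ neurons keeps $id,w,lk,\tau$, sets the new potential $p=potential(w_N,i,len)$ if $\tau_N\le CurPot(N)$ and $p=potential(w_N,i,len)+lk_N\cdot CurPot(N)$ otherwise, and sets the new output list to $(\tau_N\le p)::Output(N)$. For a list of input functions (most recent first), $AfterNsteps(N,[\,],len)=N$ and $AfterNsteps(N,i::\mathit{inp},len)$ is the one-step update of $AfterNsteps(N,\mathit{inp},len)$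 with $i$; $Output_N(\mathit{inp},len)$ denotes its output list. $N$ is initial if $Output(N)=[0]$ and $CurPot(N)=0$. $\mathit{One\_input}(N,id,len)$ means $id<len$ and $w_N(id')=0$ for all $id'\neq id$ with $id'<len$. $\mathbin{++}$ is list concatenation. -}

module Defs where

open import Data.Nat as ℕ using (ℕ; zero; suc)
open import Data.Bool using (Bool; true; false; if_then_else_)
open import Data.List using (List; []; _∷_; _++_)
open import Data.Rational using (ℚ; 0ℚ; 1ℚ; -_; _≤_; _<_; _≤ᵇ_; _+_; _*_)
open import Relation.Binary.PropositionalEquality using (_≡_)
open import Relation.Nullary using (¬_)
open import Data.Product using (_×_)

-- Booleans: false = 0, true = 1.

headB : List Bool → Bool
headB []      = false
headB (b ∷ _) = b

record Neuron : Set where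
  field
    id     : ℕ
    w      : ℕ → ℚ
    w-lo   : ∀ x → (- 1ℚ) ≤ w x
    w-hi   : ∀ x → w x ≤ 1ℚ
    w-self : w id ≡ 0ℚ
    lk     : ℚ
    lk-lo  : 0ℚ ≤ lk
    lk-hi  : lk ≤ 1ℚ
    τ      : ℚ
    τ-pos  : 0ℚ < τ
    Output : List Bool
    CurPot : ℚ
    inv    : (τ ≤ᵇ CurPot) ≡ headB Output
open Neuron public

Input : Set
Input = ℕ → Bool

potential : (ℕ → ℚ) → Input → ℕ → ℚ
potential w i zero    = 0ℚ
potential w i (suc k) = potential w i k + (if i k then w k else 0ℚ)

nextPot : Neuron → Input → ℕ → ℚ
nextPot N i len =
  if τ N ≤ᵇ CurPot N
  then potential (w N) i len
  else potential (w N) i len + lk N * CurPot N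


-- one-step update of N with input i in an environment of len neurons
step : Neuron → Input → ℕ → Neuron
step N i len = record
  { id = id N ; w = w N ; w-lo = w-lo N ; w-hi = w-hi N ; w-self = w-self N
  ; lk = lk N ; lk-lo = lk-lo N ; lk-hi = lk-hi N
  ; τ = τ N ; τ-pos = τ-pos N
  ; Output = (τ N ≤ᵇ nextPot N i len) ∷ Output N
  ; CurPot = nextPot N i len
  ; inv = Relation.Binary.PropositionalEquality.refl
  }

-- inputs listed most recent first
AfterNsteps : Neuron → List Input → ℕ → Neuron
AfterNsteps N []          len = N
AfterNsteps N (i ∷ inp)   len = step (AfterNsteps N inp len) i len

OutputN : Neuron → List Input → ℕ → List Bool
OutputN N inp len = Output (AfterNsteps N inp len)

Initial : Neuron → Set
Initial N = (Output N ≡ false ∷ []) × (CurPot N ≡ 0ℚ)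

One-input : Neuron → ℕ → ℕ → Set
One-input N i len = (i ℕ.< len) × (∀ i′ → ¬ (i′ ≡ i) → i′ ℕ.< len → w N i′ ≡ 0ℚ)

{-# OPTIONS --safe #-}
-- Once N fires its potential is reset, so its next potential is the weighted
-- input alone.  With a single input synapse that is either 0 or w N i, both
-- below the threshold, so a firing is always followed by silence.
module Submission where

open import Defs
open import Data.Nat using (ℕ; zero; suc; _≟_)
open import Data.Nat.Properties using (m<n⇒m<1+n; n<1+n; <⇒≢)
open import Data.Bool using (Bool; true; false)
open import Data.Bool.Properties using (¬-not; T-≡)
open import Data.List using (List; []; _∷_; _++_)
open import Data.List.Relation.Unary.Linked using (Linked; [-]; _∷_; tail; head)
open import Data.Rational using (ℚ; 0ℚ; _<_; _≤ᵇ_)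
open import Data.Rational.Properties using (+-identityˡ; +-identityʳ; ≤ᵇ⇒≤; <-≤-trans; <-irrefl)
open import Data.Sum using (_⊎_; inj₁; inj₂)
open import Data.Product using (_,_)
open import Function using (_∘_; Equivalence)
open import Relation.Nullary using (yes; no)
open import Relation.Binary.PropositionalEquality using (_≡_; _≢_; refl; sym; subst)
open Relation.Binary.PropositionalEquality.≡-Reasoning
import Data.Nat as ℕ

NotBoth : Bool → Bool → Set
NotBoth a b = (a ≡ false) ⊎ (b ≡ false)

Linked⇒adjacent : ∀ {A : Set} {R : A → A → Set} (l₁ : List A) {a b : A} {l₂ : List A} →
  Linked R (l₁ ++ a ∷ b ∷ l₂) → R a b
Linked⇒adjacent []       = head
Linked⇒adjacent (_ ∷ l₁) = Linked⇒adjacent l₁ ∘ tail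

<⇒≤ᵇ≡false : ∀ {p q : ℚ} → p < q → (q ≤ᵇ p) ≡ false
<⇒≤ᵇ≡false p<q = ¬-not λ q≤ᵇp →
  <-irrefl refl (<-≤-trans p<q (≤ᵇ⇒≤ (Equivalence.from T-≡ q≤ᵇp)))

potential-suc-unweighted : ∀ {w f k} → w k ≡ 0ℚ → potential w f (suc k) ≡ potential w f k
potential-suc-unweighted {w} {f} {k} wk≡0 with f k
... | true  rewrite wk≡0 = +-identityʳ _
... | false = +-identityʳ _

potential-unweighted : ∀ {w f} k → (∀ j → j ℕ.< k → w j ≡ 0ℚ) → potential w f k ≡ 0ℚ
potential-unweighted zero    _ = refl
potential-unweighted {w} {f} (suc k) w≡0 = begin
  potential w f (suc k) ≡⟨ potential-suc-unweighted {w} {f} (w≡0 k (n<1+n k)) ⟩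
  potential w f k       ≡⟨ potential-unweighted k (λ j j<k → w≡0 j (m<n⇒m<1+n j<k)) ⟩
  0ℚ                    ∎

potential-one-input : ∀ {w f i} k → (∀ j → j ≢ i → j ℕ.< k → w j ≡ 0ℚ) →
  (potential w f k ≡ 0ℚ) ⊎ (potential w f k ≡ w i)
potential-one-input zero _ = inj₁ refl
potential-one-input {w} {f} {i} (suc k) w≡0 with k ≟ i
... | no k≢i rewrite potential-suc-unweighted {w} {f} (w≡0 k k≢i (n<1+n k)) =
  potential-one-input k (λ j j≢i j<k → w≡0 j j≢i (m<n⇒m<1+n j<k))
... | yes refl rewrite potential-unweighted {w} {f} k (λ j j<k → w≡0 j (<⇒≢ j<k) (m<n⇒m<1+n j<k))
  with f k
...   | true  = inj₂ (+-identityˡ _)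
...   | false = inj₁ (+-identityˡ _)

Subthreshold : Neuron → ℕ → Set
Subthreshold N len = ∀ f → potential (w N) f len < τ N

One-input⇒Subthreshold : ∀ N i len → One-input N i len → w N i < τ N → Subthreshold N len
One-input⇒Subthreshold N i len (_ , w≡0) wi<τ f with potential-one-input {f = f} len w≡0
... | inj₁ p≡0  = subst (_< τ N) (sym p≡0) (τ-pos N)
... | inj₂ p≡wi = subst (_< τ N) (sym p≡wi) wi<τ

Subthreshold-AfterNsteps : ∀ {N len} inp → Subthreshold N len → Subthreshold (AfterNsteps N inp len) len
Subthreshold-AfterNsteps []        sub = sub
Subthreshold-AfterNsteps (_ ∷ inp) sub = Subthreshold-AfterNsteps inp sub

silent-after-firing : ∀ N f len → (τ N ≤ᵇ CurPot N) ≡ true → Subthreshold N len →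
  (τ N ≤ᵇ nextPot N f len) ≡ false
silent-after-firing N f len fired sub rewrite fired = <⇒≤ᵇ≡false (sub f)

Linked-step : ∀ N f len → Subthreshold N len → Linked NotBoth (Output N) →
  Linked NotBoth (Output (step N f len))
Linked-step N f len sub linked with Output N | inv N
... | []        | _     = [-]
... | false ∷ _ | _     = inj₂ refl ∷ linked
... | true ∷ _  | fired = inj₁ (silent-after-firing N f len fired sub) ∷ linked

Linked-AfterNsteps : ∀ N len → Subthreshold N len → Linked NotBoth (Output N) →
  ∀ inp → Linked NotBoth (OutputN N inp len)
Linked-AfterNsteps N len sub linked []        = linked
Linked-AfterNsteps N len sub linked (f ∷ inp) =
  Linked-step (AfterNsteps N inp len) f len (Subthreshold-AfterNsteps inp sub)
    (Linked-AfterNsteps N len sub linked inp)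

proposition4p9 : (N : Neuron) (i len : ℕ) → One-input N i len → Initial N → w N i < τ N →
    (inp : List Input) (a₁ a₂ : Bool) (l₁ l₂ : List Bool) →
    OutputN N inp len ≡ l₁ ++ (a₁ ∷ a₂ ∷ []) ++ l₂ → (a₁ ≡ false) ⊎ (a₂ ≡ false)
proposition4p9 N i len one (output≡ , _) wi<τ inp a₁ a₂ l₁ l₂ eq =
  Linked⇒adjacent l₁ (subst (Linked NotBoth) eq linked)
  where
  linked : Linked NotBoth (OutputN N inp len)
  linked = Linked-AfterNsteps N len (One-input⇒Subthreshold N i len one wi<τ)
    (subst (Linked NotBoth) (sym output≡) [-]) inp
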